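{- Let $\alpha=(\alpha_1,\dots,\alpha_m)$ be a sequence of integers with sum $d$ and let $r>0$. Then \[M_{(r)}^\perp\,\mathfrak{S}_\alpha=\sum_{i=1}^{m}\mathfrak{S}_{\alpha-(0^{i-1},r,0^{m-i})},\] where $\alpha-(0^{i-1},r,0^{m-i})$ is the sequence obtained from $\alpha$ by subtracting $r$ from its $i$-th entry.
   Context: $\mathsf{NSym}$ is the free associative (non-commutative) algebra over $\mathbb{Q}$ generated by $H_1,H_2,\dots$, with $H_0=1$, $H_i=0$ for $i<0$, and basis $H_\alpha=H_{\alpha_1}\cdots H_{\alpha_m}$ over compositions $\alpha$. For $\alpha\in\mathbb{Z}^m$, $\mathfrak{S}_\alpha=\sum_{\sigma\in S_m}\operatorname{sgn}(\sigma)H_{\alpha_1+\sigma(1)-1,\dots,\alpha_m+\sigma(m)-m}$. $\mathsf{QSym}\subseteq\mathbb{Q}[[x_1,x_2,\dots]]$ is spanned by $M_\alpha=\sum_{i_1<\dots<i_m}x_{i_1}^{\alpha_1}\cdots x_{i_m}^{\alpha_m}$; in particular $M_{(r)}=\sum_i x_i^r$. The pairing $\langle\cdot,\cdot\rangle:\mathsf{NSym}\times\mathsf{QSym}\to\mathbb{Q}$ satisfies $\langle H_\alpha,M_\beta\rangle=\delta_{\alpha,\beta}$, and for $G\in\mathsf{QSym}$ the operator $G^\perp$ on $\mathsf{NSym}$ is defined by $\langle G^\perp F,K\rangle=\langle F,GK\rangle$ for all $K\in\mathsf{QSym}$. -}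

module Defs where

open import Data.Nat as ℕ using (ℕ; zero; suc; _<ᵇ_)
open import Data.Integer as ℤ using (ℤ; +_; -[1+_])
open import Data.Rational as ℚ using (ℚ; 0ℚ; 1ℚ)
open import Data.List using (List; []; _∷_; _++_; map; concatMap; foldr; length; filter; upTo; sum)
open import Data.List.Properties using (≡-dec)
open import Data.List.Relation.Unary.All using (All)
open import Data.Product using (_×_; _,_)
open import Data.Maybe using (Maybe; just; nothing)
open import Data.Bool using (Bool; true; false; if_then_else_; T)
open import Relation.Nullary using (yes; no)
open import Relation.Nullary.Decidable using (⌊_⌋)

-- A composition is a list of positive naturals (positivity imposed where needed).
Comp : Set
Comp = List ℕ

_=ᶜ_ : Comp → Comp → Bool
a =ᶜ b = ⌊ ≡-dec ℕ._≟_ a b ⌋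

-- NSym: elements are finite formal Q-linear combinations Σ c · H_α of
-- the basis H_α (α a composition).  Since NSym is free, the H_α are a
-- basis and an element is determined by its coefficients.
NSym : Set
NSym = List (ℚ × Comp)

_·ᴺ_ : ℚ → NSym → NSym
c ·ᴺ F = map (λ { (e , α) → (c ℚ.* e , α) }) F

-- H_α for α an arbitrary integer sequence: H_0 = 1, H_i = 0 for i < 0,
-- H_α = H_{α₁} ⋯ H_{αₘ}.  Zero entries are dropped, any negative entry
-- makes the product 0.
toComp : List ℤ → Maybe Comp
toComp [] = just []
toComp (-[1+ n ] ∷ xs) = nothing
toComp (+ zero ∷ xs) = toComp xs
toComp (+ suc n ∷ xs) with toComp xs
... | just c = just (suc n ∷ c)
... | nothing = nothing

Hℤ : List ℤ → NSym
Hℤ xs with toComp xs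
... | just c = (1ℚ , c) ∷ []
... | nothing = []

-- Permutations of [1..m] as lists (σ(1), …, σ(m)).
insertAll : ℕ → List ℕ → List (List ℕ)
insertAll x [] = (x ∷ []) ∷ []
insertAll x (y ∷ ys) = (x ∷ y ∷ ys) ∷ map (y ∷_) (insertAll x ys)

perms : ℕ → List (List ℕ)
perms zero = [] ∷ []
perms (suc m) = concatMap (insertAll (suc m)) (perms m)

inv : List ℕ → ℕ
inv [] = 0
inv (x ∷ xs) = length (filter (λ y → y ℕ.<? x) xs) ℕ.+ inv xs

sgn : List ℕ → ℚ
sgn σ = go (inv σ)
  where
  go : ℕ → ℚ
  go zero = 1ℚ
  go (suc n) = ℚ.- go n

-- (α₁+σ(1)-1, …, αₘ+σ(m)-m); i is the 1-based position
shiftBy : ℕ → List ℤ → List ℕ → List ℤ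
shiftBy i (a ∷ as) (s ∷ ss) = (a ℤ.+ + s ℤ.- + i) ∷ shiftBy (suc i) as ss
shiftBy i _ _ = []

𝔖 : List ℤ → NSym
𝔖 α = concatMap (λ σ → sgn σ ·ᴺ Hℤ (shiftBy 1 α σ)) (perms (length α))

-- QSym: finite formal Q-linear combinations Σ c · M_β of monomial
-- quasisymmetric functions; product on the M basis is the
-- quasi-shuffle (overlapping shuffle) product, which is the product of
-- the corresponding power series.
QSym : Set
QSym = List (ℚ × Comp)

IsQSym : QSym → Set
IsQSym K = All (λ { (_ , β) → All (λ n → 0 ℕ.< n) β }) K

qsh : Comp → Comp → List Comp
qsh [] β = β ∷ []
qsh (a ∷ α) [] = (a ∷ α) ∷ []
qsh (a ∷ α) (b ∷ β) =
  map (a ∷_) (qsh α (b ∷ β)) ++ map (b ∷_) (qsh (a ∷ α) β) ++ map ((a ℕ.+ b) ∷_) (qsh α β)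

_*ᴽ_ : QSym → QSym → QSym
G *ᴽ K = concatMap (λ { (c , α) → concatMap (λ { (e , β) → map (λ γ → (c ℚ.* e , γ)) (qsh α β) }) K }) G

M : Comp → QSym
M β = (1ℚ , β) ∷ []

⟨_,_⟩ : NSym → QSym → ℚ
⟨ F , K ⟩ = foldr ℚ._+_ 0ℚ
  (concatMap (λ { (c , α) → map (λ { (e , β) → if α =ᶜ β then c ℚ.* e else 0ℚ }) K }) F)

-- "G^⊥ F = F'" : the defining property ⟨G^⊥ F, K⟩ = ⟨F, G K⟩ for all K ∈ QSym.
-- (The pairing is nondegenerate, so this determines G^⊥ F uniquely.)
_⊥_≡_ : QSym → NSym → NSym → Set
G ⊥ F ≡ F' = ∀ (K : QSym) → IsQSym K → ⟨ F' , K ⟩ ≡ ⟨ F , G *ᴽ K ⟩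
  where open import Relation.Binary.PropositionalEquality using (_≡_)

ΣN : List NSym → NSym
ΣN = foldr _++_ []

-- α - (0^{i-1}, r, 0^{m-i}), with i given 0-based here
subAt : ℕ → ℕ → List ℤ → List ℤ
subAt _ r [] = []
subAt zero r (a ∷ as) = (a ℤ.- + r) ∷ as
subAt (suc i) r (a ∷ as) = a ∷ subAt i r as

-- The pairing makes H_β and M_β dual, and M_(r) M_β is the sum of M_γ over the
-- quasi-shuffles γ of (r) with β.  Hence ⟨H_xs, M_(r) M_β⟩ counts those γ equal to the
-- composition of xs, and peeling off the first entry of xs shows that this count equals
-- the number of positions i at which subtracting r from xs leaves β: this is the rule
-- M_(r)^⊥ H_xs = Σ_i H_{xs - r e_i}.  Subtracting r at position i commutes with the
-- shift α ↦ α + σ - id, so the statement for 𝔖_α follows by linearity of the pairing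
-- and exchanging the sums over i and σ.

module Submission where

open import Defs
open import Algebra.Bundles using (CommutativeMonoid; CommutativeSemiring; CommutativeRing)
open import Data.Bool using (true; false; if_then_else_)
open import Data.Empty using (⊥-elim)
open import Data.Integer as ℤ using (ℤ; +_; -[1+_]; _⊖_)
open import Data.Integer.Properties as ℤP using ()
open import Data.Integer.Tactic.RingSolver using (solve-∀)
open import Data.List using (List; []; _∷_; _++_; map; concatMap; foldr; upTo; length)
open import Data.List.Properties
  using (≡-dec; map-∘; map-++; map-concatMap; map-upTo; ++-identityʳ; concatMap-cong;
         ∷-injectiveˡ; ∷-injectiveʳ)
open import Data.List.Relation.Unary.All as All using (All; []; _∷_)
import Data.List.Relation.Unary.All.Properties as Allₚ
open import Data.Maybe using (maybe′; just; nothing)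
open import Data.Nat as ℕ using (ℕ; zero; suc; _<_; compare; less; equal; greater)
open import Data.Nat.Properties as ℕP using ()
open import Data.Product using (_×_; _,_; proj₁; proj₂; uncurry)
open import Data.Rational using (ℚ; 0ℚ; 1ℚ)
open import Data.Rational.Properties as ℚP using ()
open import Function using (_∘_)
open import Level using (Level)
open import Relation.Binary.Definitions using (DecidableEquality)
open import Relation.Binary.PropositionalEquality as ≡ using (_≡_; _≢_; refl; cong; cong₂)
open import Relation.Nullary using (Dec; yes; no)
open import Relation.Nullary.Decidable using (⌊_⌋)

module ListSum {c ℓ} (R : CommutativeSemiring c ℓ) where
  open CommutativeSemiring R renaming (refl to ≈-refl)
  open import Algebra.Properties.CommutativeSemigroup +-commutativeSemigroup using (interchange)

  private variable
    a b : Level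
    A : Set a
    B : Set b

  sum : List Carrier → Carrier
  sum = foldr _+_ 0#

  ∑ : List A → (A → Carrier) → Carrier
  ∑ xs f = sum (map f xs)

  sum-++ : ∀ (xs ys : List Carrier) → sum (xs ++ ys) ≈ sum xs + sum ys
  sum-++ [] ys = sym (+-identityˡ _)
  sum-++ (x ∷ xs) ys = trans (+-congˡ (sum-++ xs ys)) (sym (+-assoc x _ _))

  sum-concatMap : ∀ (g : A → List Carrier) xs → sum (concatMap g xs) ≈ ∑ xs (sum ∘ g)
  sum-concatMap g [] = ≈-refl
  sum-concatMap g (x ∷ xs) = trans (sum-++ (g x) (concatMap g xs)) (+-congˡ (sum-concatMap g xs))

  ∑-++ : ∀ (xs ys : List A) f → ∑ (xs ++ ys) f ≈ ∑ xs f + ∑ ys f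
  ∑-++ xs ys f = trans (reflexive (cong sum (map-++ f xs ys))) (sum-++ (map f xs) (map f ys))

  ∑-map : ∀ (g : A → B) xs (f : B → Carrier) → ∑ (map g xs) f ≡ ∑ xs (f ∘ g)
  ∑-map g xs f = cong sum (≡.sym (map-∘ xs))

  ∑-concatMap : ∀ (g : A → List B) xs (f : B → Carrier) →
                ∑ (concatMap g xs) f ≈ ∑ xs (λ x → ∑ (g x) f)
  ∑-concatMap g xs f =
    trans (reflexive (cong sum (map-concatMap f g xs))) (sum-concatMap (map f ∘ g) xs)

  ∑-congᴬ : ∀ {xs : List A} {f g} → All (λ x → f x ≈ g x) xs → ∑ xs f ≈ ∑ xs g
  ∑-congᴬ [] = ≈-refl
  ∑-congᴬ (e ∷ es) = +-cong e (∑-congᴬ es)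

  ∑-cong : ∀ (xs : List A) {f g} → (∀ x → f x ≈ g x) → ∑ xs f ≈ ∑ xs g
  ∑-cong [] e = ≈-refl
  ∑-cong (x ∷ xs) e = +-cong (e x) (∑-cong xs e)

  ∑-zero : ∀ (xs : List A) {f} → (∀ x → f x ≈ 0#) → ∑ xs f ≈ 0#
  ∑-zero [] e = ≈-refl
  ∑-zero (x ∷ xs) e = trans (+-cong (e x) (∑-zero xs e)) (+-identityˡ 0#)

  ∑-+ : ∀ (xs : List A) f g → ∑ xs (λ x → f x + g x) ≈ ∑ xs f + ∑ xs g
  ∑-+ [] f g = sym (+-identityˡ 0#)
  ∑-+ (x ∷ xs) f g = trans (+-congˡ (∑-+ xs f g)) (interchange (f x) (g x) _ _)

  ∑-*ˡ : ∀ (xs : List A) k f → ∑ xs (λ x → k * f x) ≈ k * ∑ xs f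
  ∑-*ˡ [] k f = sym (zeroʳ k)
  ∑-*ˡ (x ∷ xs) k f = trans (+-congˡ (∑-*ˡ xs k f)) (sym (distribˡ k (f x) _))

  ∑-swap : (xs : List A) (ys : List B) (f : A → B → Carrier) →
           ∑ xs (λ x → ∑ ys (f x)) ≈ ∑ ys (λ y → ∑ xs (λ x → f x y))
  ∑-swap [] ys f = sym (∑-zero ys (λ _ → ≈-refl))
  ∑-swap (x ∷ xs) ys f = trans (+-congˡ (∑-swap xs ys f)) (sym (∑-+ ys (f x) _))

  ∑-upTo-suc : ∀ n f → ∑ (upTo (suc n)) f ≡ f 0 + ∑ (upTo n) (f ∘ suc)
  ∑-upTo-suc n f =
    cong (λ t → f 0 + t) (≡.trans (cong (λ is → ∑ is f) (≡.sym (map-upTo suc n))) (∑-map suc (upTo n) f))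

open ListSum (CommutativeRing.commutativeSemiring ℚP.+-*-commutativeRing)
open import Data.Rational using (_+_; _*_)
open import Algebra.Properties.CommutativeSemigroup
  (CommutativeMonoid.commutativeSemigroup ℚP.+-0-commutativeMonoid) using (x∙yz≈xz∙y)

module Kronecker {a} {A : Set a} (_≟_ : DecidableEquality A) where

  δ : A → A → ℚ
  δ x y = if ⌊ x ≟ y ⌋ then 1ℚ else 0ℚ

  δ-refl : ∀ x → δ x x ≡ 1ℚ
  δ-refl x with x ≟ x
  ... | yes _ = refl
  ... | no x≢x = ⊥-elim (x≢x refl)

  δ-≢ : ∀ {x y} → x ≢ y → δ x y ≡ 0ℚ
  δ-≢ {x} {y} x≢y with x ≟ y
  ... | yes x≡y = ⊥-elim (x≢y x≡y)
  ... | no _ = refl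

  δ-refl-* : ∀ x q → δ x x * q ≡ q
  δ-refl-* x q = ≡.trans (cong (_* q) (δ-refl x)) (ℚP.*-identityˡ q)

  δ-≢-* : ∀ {x y} → x ≢ y → ∀ q → δ x y * q ≡ 0ℚ
  δ-≢-* x≢y q = ≡.trans (cong (_* q) (δ-≢ x≢y)) (ℚP.*-zeroˡ q)

  δ-injective : ∀ (f : A → A) → (∀ {x y} → f x ≡ f y → x ≡ y) →
                ∀ x y → δ (f x) (f y) ≡ δ x y
  δ-injective f f-inj x y with x ≟ y
  ... | yes refl = δ-refl (f x)
  ... | no x≢y = δ-≢ (x≢y ∘ f-inj)

open Kronecker ℕ._≟_
open Kronecker (≡-dec ℕ._≟_) using () renaming (δ to δᶜ; δ-refl to δᶜ-refl; δ-≢ to δᶜ-≢)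

δᶜ-∷ : ∀ a α b β → δᶜ (a ∷ α) (b ∷ β) ≡ δ a b * δᶜ α β
δᶜ-∷ a α b β = by-cases (a ℕ.≟ b) (≡-dec ℕ._≟_ α β)
  where
  by-cases : ∀ {a α b β} → Dec (a ≡ b) → Dec (α ≡ β) → δᶜ (a ∷ α) (b ∷ β) ≡ δ a b * δᶜ α β
  by-cases {a} {α} (yes refl) (yes refl) =
    ≡.trans (δᶜ-refl (a ∷ α)) (≡.sym (cong₂ _*_ (δ-refl a) (δᶜ-refl α)))
  by-cases {a} (yes refl) (no α≢β) =
    ≡.trans (δᶜ-≢ (α≢β ∘ ∷-injectiveʳ))
            (≡.sym (≡.trans (cong (δ a a *_) (δᶜ-≢ α≢β)) (ℚP.*-zeroʳ (δ a a))))
  by-cases {α = α} {β = β} (no a≢b) _ =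
    ≡.trans (δᶜ-≢ (a≢b ∘ ∷-injectiveˡ))
            (≡.sym (≡.trans (cong (_* δᶜ α β) (δ-≢ a≢b)) (ℚP.*-zeroˡ (δᶜ α β))))

⟨H_,M_⟩ : List ℤ → Comp → ℚ
⟨H xs ,M β ⟩ = maybe′ (λ α → δᶜ α β) 0ℚ (toComp xs)

⟨H,M⟩-[1+n]-[] : ∀ n ys → ⟨H + suc n ∷ ys ,M [] ⟩ ≡ 0ℚ
⟨H,M⟩-[1+n]-[] n ys with toComp ys
... | just _ = refl
... | nothing = refl

⟨H,M⟩-[1+n]-∷ : ∀ n ys b β → ⟨H + suc n ∷ ys ,M b ∷ β ⟩ ≡ δ (suc n) b * ⟨H ys ,M β ⟩
⟨H,M⟩-[1+n]-∷ n ys b β with toComp ys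
... | just α = δᶜ-∷ (suc n) α b β
... | nothing = ≡.sym (ℚP.*-zeroʳ (δ (suc n) b))

m⊖[1+m+k]≡-[1+k] : ∀ m k → m ⊖ suc (m ℕ.+ k) ≡ -[1+ k ]
m⊖[1+m+k]≡-[1+k] zero k = refl
m⊖[1+m+k]≡-[1+k] (suc m) k =
  ≡.trans (ℤP.[1+m]⊖[1+n]≡m⊖n m (suc (m ℕ.+ k))) (m⊖[1+m+k]≡-[1+k] m k)

[1+m+k]⊖m≡+[1+k] : ∀ m k → suc (m ℕ.+ k) ⊖ m ≡ + suc k
[1+m+k]⊖m≡+[1+k] zero k = refl
[1+m+k]⊖m≡+[1+k] (suc m) k =
  ≡.trans (ℤP.[1+m]⊖[1+n]≡m⊖n (suc (m ℕ.+ k)) m) ([1+m+k]⊖m≡+[1+k] m k)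

⟨H,M⟩-sub-[] : ∀ m r ys → ⟨H (+ m ℤ.- + r) ∷ ys ,M [] ⟩ ≡ δ m r * ⟨H ys ,M [] ⟩
⟨H,M⟩-sub-[] m r ys rewrite ℤP.[+m]-[+n]≡m⊖n m r with compare m r
... | less m k rewrite m⊖[1+m+k]≡-[1+k] m k = ≡.sym (δ-≢-* (ℕP.m≢1+m+n m) _)
... | equal m rewrite ℤP.n⊖n≡0 m = ≡.sym (δ-refl-* m _)
... | greater r k rewrite [1+m+k]⊖m≡+[1+k] r k =
  ≡.trans (⟨H,M⟩-[1+n]-[] k ys) (≡.sym (δ-≢-* (ℕP.m≢1+m+n r ∘ ≡.sym) _))

⟨H,M⟩-sub-∷ : ∀ m r ys {b} β → 0 < b →
  ⟨H (+ m ℤ.- + r) ∷ ys ,M b ∷ β ⟩ ≡ δ m r * ⟨H ys ,M b ∷ β ⟩ + δ m (r ℕ.+ b) * ⟨H ys ,M β ⟩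
⟨H,M⟩-sub-∷ m r ys {b} β 0<b rewrite ℤP.[+m]-[+n]≡m⊖n m r with compare m r
... | less m k rewrite m⊖[1+m+k]≡-[1+k] m k = ≡.sym (≡.trans
  (cong₂ _+_ (δ-≢-* (ℕP.m≢1+m+n m) _) (δ-≢-* m≢1+m+k+b _))
  (ℚP.+-identityˡ 0ℚ))
  where
  m≢1+m+k+b : m ≢ suc (m ℕ.+ k) ℕ.+ b
  m≢1+m+k+b eq = ℕP.m≢1+m+n m (≡.trans eq (cong suc (ℕP.+-assoc m k b)))
... | equal m rewrite ℤP.n⊖n≡0 m = ≡.sym (≡.trans
  (cong₂ _+_ (δ-refl-* m _) (δ-≢-* (ℕP.<⇒≢ (ℕP.m<m+n m 0<b)) _))
  (ℚP.+-identityʳ _))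
... | greater r k rewrite [1+m+k]⊖m≡+[1+k] r k = ≡.trans (⟨H,M⟩-[1+n]-∷ k ys b β) (≡.sym (≡.trans
  (cong₂ _+_ (δ-≢-* (ℕP.m≢1+m+n r ∘ ≡.sym) _) (cong (_* ⟨H ys ,M β ⟩) δ-cancel))
  (ℚP.+-identityˡ _)))
  where
  δ-cancel : δ (suc (r ℕ.+ k)) (r ℕ.+ b) ≡ δ (suc k) b
  δ-cancel = ≡.trans (cong (λ x → δ x (r ℕ.+ b)) (≡.sym (ℕP.+-suc r k)))
                     (δ-injective (r ℕ.+_) (ℕP.+-cancelˡ-≡ r _ _) (suc k) b)

∑-qsh-[] : ∀ r (f : Comp → ℚ) → ∑ (qsh (r ∷ []) []) f ≡ f (r ∷ [])
∑-qsh-[] r f = ℚP.+-identityʳ (f (r ∷ []))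

∑-qsh-∷ : ∀ r b β (f : Comp → ℚ) →
  ∑ (qsh (r ∷ []) (b ∷ β)) f
    ≡ (f (r ∷ b ∷ β) + f ((r ℕ.+ b) ∷ β)) + ∑ (qsh (r ∷ []) β) (f ∘ (b ∷_))
∑-qsh-∷ r b β f = begin
  f (r ∷ b ∷ β) + ∑ (map (b ∷_) (qsh (r ∷ []) β) ++ ((r ℕ.+ b) ∷ β) ∷ []) f
    ≡⟨ cong (λ t → f (r ∷ b ∷ β) + t) (∑-++ (map (b ∷_) (qsh (r ∷ []) β)) _ f) ⟩
  f (r ∷ b ∷ β) + (∑ (map (b ∷_) (qsh (r ∷ []) β)) f + (f ((r ℕ.+ b) ∷ β) + 0ℚ))
    ≡⟨ cong (λ t → f (r ∷ b ∷ β) + t)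
            (cong₂ _+_ (∑-map (b ∷_) (qsh (r ∷ []) β) f) (ℚP.+-identityʳ _)) ⟩
  f (r ∷ b ∷ β) + (∑ (qsh (r ∷ []) β) (f ∘ (b ∷_)) + f ((r ℕ.+ b) ∷ β))
    ≡⟨ x∙yz≈xz∙y (f (r ∷ b ∷ β)) (∑ (qsh (r ∷ []) β) (f ∘ (b ∷_))) (f ((r ℕ.+ b) ∷ β)) ⟩
  (f (r ∷ b ∷ β) + f ((r ℕ.+ b) ∷ β)) + ∑ (qsh (r ∷ []) β) (f ∘ (b ∷_)) ∎
  where open ≡.≡-Reasoning

∑-qsh-⟨H[],M⟩ : ∀ r β → ∑ (qsh (r ∷ []) β) ⟨H [] ,M_⟩ ≡ 0ℚ
∑-qsh-⟨H[],M⟩ r [] = ∑-qsh-[] r ⟨H [] ,M_⟩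
∑-qsh-⟨H[],M⟩ r (b ∷ β) = ≡.trans (∑-qsh-∷ r b β ⟨H [] ,M_⟩)
  (≡.trans (cong₂ _+_ (ℚP.+-identityˡ 0ℚ) (∑-zero (qsh (r ∷ []) β) (λ _ → refl)))
           (ℚP.+-identityˡ 0ℚ))

-- The positivity of r enters where xs has an entry 0: subtracting r there makes the entry negative.
∑-⟨H,M⟩-subAt : ∀ r xs β → All (0 <_) β →
  ∑ (upTo (length xs)) (λ i → ⟨H subAt i (suc r) xs ,M β ⟩) ≡ ∑ (qsh (suc r ∷ []) β) ⟨H xs ,M_⟩
∑-⟨H,M⟩-subAt r [] β _ = ≡.sym (∑-qsh-⟨H[],M⟩ (suc r) β)
∑-⟨H,M⟩-subAt r (-[1+ k ] ∷ ys) β _ = ≡.trans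
  (∑-zero (upTo (suc (length ys))) {λ i → ⟨H subAt i (suc r) (-[1+ k ] ∷ ys) ,M β ⟩}
          λ { zero → refl ; (suc _) → refl })
  (≡.sym (∑-zero (qsh (suc r ∷ []) β) {⟨H -[1+ k ] ∷ ys ,M_⟩} (λ _ → refl)))
∑-⟨H,M⟩-subAt r (+ zero ∷ ys) β β>0 = begin
  ∑ (upTo (suc (length ys))) (λ i → ⟨H subAt i (suc r) (+ zero ∷ ys) ,M β ⟩)
    ≡⟨ ∑-upTo-suc (length ys) (λ i → ⟨H subAt i (suc r) (+ zero ∷ ys) ,M β ⟩) ⟩
  0ℚ + ∑ (upTo (length ys)) (λ i → ⟨H subAt i (suc r) ys ,M β ⟩)
    ≡⟨ ℚP.+-identityˡ _ ⟩
  ∑ (upTo (length ys)) (λ i → ⟨H subAt i (suc r) ys ,M β ⟩)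
    ≡⟨ ∑-⟨H,M⟩-subAt r ys β β>0 ⟩
  ∑ (qsh (suc r ∷ []) β) ⟨H ys ,M_⟩ ∎
  where open ≡.≡-Reasoning
∑-⟨H,M⟩-subAt r (+ suc n ∷ ys) [] _ = begin
  ∑ (upTo (suc (length ys))) (λ i → ⟨H subAt i (suc r) (+ suc n ∷ ys) ,M [] ⟩)
    ≡⟨ ∑-upTo-suc (length ys) (λ i → ⟨H subAt i (suc r) (+ suc n ∷ ys) ,M [] ⟩) ⟩
  ⟨H (+ suc n ℤ.- + suc r) ∷ ys ,M [] ⟩
    + ∑ (upTo (length ys)) (λ i → ⟨H + suc n ∷ subAt i (suc r) ys ,M [] ⟩)
    ≡⟨ cong₂ _+_ (⟨H,M⟩-sub-[] (suc n) (suc r) ys)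
                 (∑-zero (upTo (length ys)) (λ i → ⟨H,M⟩-[1+n]-[] n (subAt i (suc r) ys))) ⟩
  δ (suc n) (suc r) * ⟨H ys ,M [] ⟩ + 0ℚ
    ≡⟨ cong (_+ 0ℚ) (≡.sym (⟨H,M⟩-[1+n]-∷ n ys (suc r) [])) ⟩
  ∑ (qsh (suc r ∷ []) []) ⟨H + suc n ∷ ys ,M_⟩ ∎
  where open ≡.≡-Reasoning
∑-⟨H,M⟩-subAt r (+ suc n ∷ ys) (b ∷ β) (b>0 ∷ β>0) = begin
  ∑ (upTo (suc (length ys))) (λ i → ⟨H subAt i (suc r) (+ suc n ∷ ys) ,M b ∷ β ⟩)
    ≡⟨ ∑-upTo-suc (length ys) (λ i → ⟨H subAt i (suc r) (+ suc n ∷ ys) ,M b ∷ β ⟩) ⟩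
  ⟨H (+ suc n ℤ.- + suc r) ∷ ys ,M b ∷ β ⟩
    + ∑ (upTo (length ys)) (λ i → ⟨H + suc n ∷ subAt i (suc r) ys ,M b ∷ β ⟩)
    ≡⟨ cong₂ _+_ (⟨H,M⟩-sub-∷ (suc n) (suc r) ys β b>0) ∑-later-positions ⟩
  (δ (suc n) (suc r) * ⟨H ys ,M b ∷ β ⟩ + δ (suc n) (suc r ℕ.+ b) * ⟨H ys ,M β ⟩)
    + δ (suc n) b * ∑ (qsh (suc r ∷ []) β) ⟨H ys ,M_⟩
    ≡⟨ cong₂ _+_ (cong₂ _+_ (⟨H,M⟩-[1+n]-∷ n ys (suc r) (b ∷ β)) (⟨H,M⟩-[1+n]-∷ n ys (suc r ℕ.+ b) β))
                 ∑-qsh-after-b ⟨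
  (⟨H + suc n ∷ ys ,M suc r ∷ b ∷ β ⟩ + ⟨H + suc n ∷ ys ,M (suc r ℕ.+ b) ∷ β ⟩)
    + ∑ (qsh (suc r ∷ []) β) (λ γ → ⟨H + suc n ∷ ys ,M b ∷ γ ⟩)
    ≡⟨ ≡.sym (∑-qsh-∷ (suc r) b β ⟨H + suc n ∷ ys ,M_⟩) ⟩
  ∑ (qsh (suc r ∷ []) (b ∷ β)) ⟨H + suc n ∷ ys ,M_⟩ ∎
  where
  open ≡.≡-Reasoning
  ∑-later-positions : ∑ (upTo (length ys)) (λ i → ⟨H + suc n ∷ subAt i (suc r) ys ,M b ∷ β ⟩)
                    ≡ δ (suc n) b * ∑ (qsh (suc r ∷ []) β) ⟨H ys ,M_⟩
  ∑-later-positions =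
    ≡.trans (∑-cong (upTo (length ys)) (λ i → ⟨H,M⟩-[1+n]-∷ n (subAt i (suc r) ys) b β))
    (≡.trans (∑-*ˡ (upTo (length ys)) (δ (suc n) b) (λ i → ⟨H subAt i (suc r) ys ,M β ⟩))
             (cong (δ (suc n) b *_) (∑-⟨H,M⟩-subAt r ys β β>0)))
  ∑-qsh-after-b : ∑ (qsh (suc r ∷ []) β) (λ γ → ⟨H + suc n ∷ ys ,M b ∷ γ ⟩)
                ≡ δ (suc n) b * ∑ (qsh (suc r ∷ []) β) ⟨H ys ,M_⟩
  ∑-qsh-after-b = ≡.trans (∑-cong (qsh (suc r ∷ []) β) (λ γ → ⟨H,M⟩-[1+n]-∷ n ys b γ))
                       (∑-*ˡ (qsh (suc r ∷ []) β) (δ (suc n) b) ⟨H ys ,M_⟩)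

pairingᴮ : ℚ × Comp → ℚ × Comp → ℚ
pairingᴮ (c , α) (e , β) = if α =ᶜ β then c * e else 0ℚ

pairing-∑ : ∀ F K → ⟨ F , K ⟩ ≡ ∑ F (λ p → ∑ K (pairingᴮ p))
pairing-∑ F K = sum-concatMap _ F

pairing-++ˡ : ∀ F G K → ⟨ F ++ G , K ⟩ ≡ ⟨ F , K ⟩ + ⟨ G , K ⟩
pairing-++ˡ F G K = ≡.trans (pairing-∑ (F ++ G) K)
  (≡.trans (∑-++ F G _) (≡.sym (cong₂ _+_ (pairing-∑ F K) (pairing-∑ G K))))

pairing-concatMapˡ : ∀ {a} {A : Set a} (g : A → NSym) xs K →
                     ⟨ concatMap g xs , K ⟩ ≡ ∑ xs (λ x → ⟨ g x , K ⟩)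
pairing-concatMapˡ g [] K = refl
pairing-concatMapˡ g (x ∷ xs) K =
  ≡.trans (pairing-++ˡ (g x) (concatMap g xs) K)
          (cong (λ t → ⟨ g x , K ⟩ + t) (pairing-concatMapˡ g xs K))

pairing-·ˡ : ∀ c F K → ⟨ c ·ᴺ F , K ⟩ ≡ c * ⟨ F , K ⟩
pairing-·ˡ c F K = begin
  ⟨ c ·ᴺ F , K ⟩                                         ≡⟨ pairing-∑ (c ·ᴺ F) K ⟩
  ∑ (c ·ᴺ F) (λ p → ∑ K (pairingᴮ p))                   ≡⟨ ∑-map _ F _ ⟩
  ∑ F (λ p → ∑ K (pairingᴮ (c * proj₁ p , proj₂ p)))   ≡⟨ ∑-cong F (λ p → ∑-cong K (scale p)) ⟩
  ∑ F (λ p → ∑ K (λ q → c * pairingᴮ p q))             ≡⟨ ∑-cong F (λ p → ∑-*ˡ K c (pairingᴮ p)) ⟩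
  ∑ F (λ p → c * ∑ K (pairingᴮ p))                     ≡⟨ ∑-*ˡ F c _ ⟩
  c * ∑ F (λ p → ∑ K (pairingᴮ p))                     ≡⟨ cong (c *_) (pairing-∑ F K) ⟨
  c * ⟨ F , K ⟩                                          ∎
  where
  open ≡.≡-Reasoning
  scale : ∀ p q → pairingᴮ (c * proj₁ p , proj₂ p) q ≡ c * pairingᴮ p q
  scale (d , α) (e , β) with α =ᶜ β
  ... | true = ℚP.*-assoc c d e
  ... | false = ≡.sym (ℚP.*-zeroʳ c)

pairing-concatMap-· : ∀ {a} {A : Set a} (c : A → ℚ) (F : A → NSym) xs K →
  ⟨ concatMap (λ x → c x ·ᴺ F x) xs , K ⟩ ≡ ∑ xs (λ x → c x * ⟨ F x , K ⟩)
pairing-concatMap-· c F xs K =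
  ≡.trans (pairing-concatMapˡ _ xs K) (∑-cong xs (λ x → pairing-·ˡ (c x) (F x) K))

pairing-Hℤ : ∀ xs K → ⟨ Hℤ xs , K ⟩ ≡ ∑ K (uncurry λ e β → e * ⟨H xs ,M β ⟩)
pairing-Hℤ xs K with toComp xs
... | just α = ≡.trans (pairing-∑ ((1ℚ , α) ∷ []) K)
  (≡.trans (ℚP.+-identityʳ _) (∑-cong K λ (e , β) → if-δ (α =ᶜ β) e))
  where
  if-δ : ∀ b e → (if b then 1ℚ * e else 0ℚ) ≡ e * (if b then 1ℚ else 0ℚ)
  if-δ true e = ≡.trans (ℚP.*-identityˡ e) (≡.sym (ℚP.*-identityʳ e))
  if-δ false e = ≡.sym (ℚP.*-zeroʳ e)
... | nothing = ≡.sym (∑-zero K (λ (e , _) → ℚP.*-zeroʳ e))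

pairing-Hℤ-M* : ∀ xs γ K → ⟨ Hℤ xs , M γ *ᴽ K ⟩ ≡ ∑ K (uncurry λ e β → e * ∑ (qsh γ β) ⟨H xs ,M_⟩)
pairing-Hℤ-M* xs γ K = begin
  ⟨ Hℤ xs , M γ *ᴽ K ⟩
    ≡⟨ pairing-Hℤ xs (M γ *ᴽ K) ⟩
  ∑ (L ++ []) f
    ≡⟨ cong (λ l → ∑ l f) (++-identityʳ L) ⟩
  ∑ L f
    ≡⟨ ∑-concatMap _ K f ⟩
  ∑ K (λ (e , β) → ∑ (map (λ ζ → (1ℚ * e , ζ)) (qsh γ β)) f)
    ≡⟨ ∑-cong K (λ (e , β) → ∑-map _ (qsh γ β) f) ⟩
  ∑ K (λ (e , β) → ∑ (qsh γ β) (λ ζ → (1ℚ * e) * ⟨H xs ,M ζ ⟩))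
    ≡⟨ ∑-cong K (λ (e , β) → ∑-*ˡ (qsh γ β) (1ℚ * e) _) ⟩
  ∑ K (λ (e , β) → (1ℚ * e) * ∑ (qsh γ β) ⟨H xs ,M_⟩)
    ≡⟨ ∑-cong K (λ (e , β) → cong (_* _) (ℚP.*-identityˡ e)) ⟩
  ∑ K (uncurry λ e β → e * ∑ (qsh γ β) ⟨H xs ,M_⟩) ∎
  where
  open ≡.≡-Reasoning
  L : QSym
  L = concatMap (λ (e , β) → map (λ ζ → (1ℚ * e , ζ)) (qsh γ β)) K
  f : ℚ × Comp → ℚ
  f = uncurry λ e β → e * ⟨H xs ,M β ⟩

M⊥Hℤ : ∀ r xs → M (suc r ∷ []) ⊥ Hℤ xs ≡ ΣN (map (λ i → Hℤ (subAt i (suc r) xs)) (upTo (length xs)))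
M⊥Hℤ r xs K K∈QSym = begin
  ⟨ ΣN (map (λ i → Hℤ (subAt i (suc r) xs)) (upTo n)) , K ⟩
    ≡⟨ pairing-concatMapˡ (λ i → Hℤ (subAt i (suc r) xs)) (upTo n) K ⟩
  ∑ (upTo n) (λ i → ⟨ Hℤ (subAt i (suc r) xs) , K ⟩)
    ≡⟨ ∑-cong (upTo n) (λ i → pairing-Hℤ (subAt i (suc r) xs) K) ⟩
  ∑ (upTo n) (λ i → ∑ K (uncurry λ e β → e * ⟨H subAt i (suc r) xs ,M β ⟩))
    ≡⟨ ∑-swap (upTo n) K _ ⟩
  ∑ K (λ (e , β) → ∑ (upTo n) (λ i → e * ⟨H subAt i (suc r) xs ,M β ⟩))
    ≡⟨ ∑-congᴬ (All.map (λ {(e , β)} β>0 →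
         ≡.trans (∑-*ˡ (upTo n) e _) (cong (e *_) (∑-⟨H,M⟩-subAt r xs β β>0))) K∈QSym) ⟩
  ∑ K (uncurry λ e β → e * ∑ (qsh (suc r ∷ []) β) ⟨H xs ,M_⟩)
    ≡⟨ pairing-Hℤ-M* xs (suc r ∷ []) K ⟨
  ⟨ Hℤ xs , M (suc r ∷ []) *ᴽ K ⟩ ∎
  where
  open ≡.≡-Reasoning
  n : ℕ
  n = length xs

length-subAt : ∀ i r as → length (subAt i r as) ≡ length as
length-subAt _ r [] = refl
length-subAt zero r (a ∷ as) = refl
length-subAt (suc i) r (a ∷ as) = cong suc (length-subAt i r as)

length-shiftBy : ∀ k as ss → length ss ≡ length as → length (shiftBy k as ss) ≡ length as
length-shiftBy k [] [] _ = refl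
length-shiftBy k (a ∷ as) (s ∷ ss) eq = cong suc (length-shiftBy (suc k) as ss (ℕP.suc-injective eq))

shiftBy-subAt : ∀ k i r as ss → shiftBy k (subAt i r as) ss ≡ subAt i r (shiftBy k as ss)
shiftBy-subAt k i r [] ss = refl
shiftBy-subAt k zero r (a ∷ as) [] = refl
shiftBy-subAt k (suc i) r (a ∷ as) [] = refl
shiftBy-subAt k zero r (a ∷ as) (s ∷ ss) = cong (_∷ shiftBy (suc k) as ss) (sub-comm a (+ r) (+ s) (+ k))
  where
  sub-comm : ∀ (a r s k : ℤ) → (a ℤ.- r) ℤ.+ s ℤ.- k ≡ (a ℤ.+ s ℤ.- k) ℤ.- r
  sub-comm = solve-∀
shiftBy-subAt k (suc i) r (a ∷ as) (s ∷ ss) = cong (_ ∷_) (shiftBy-subAt (suc k) i r as ss)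

insertAll-length : ∀ x ys → All (λ σ → length σ ≡ suc (length ys)) (insertAll x ys)
insertAll-length x [] = refl ∷ []
insertAll-length x (y ∷ ys) = refl ∷ Allₚ.map⁺ (All.map (cong suc) (insertAll-length x ys))

perms-length : ∀ m → All (λ σ → length σ ≡ m) (perms m)
perms-length zero = refl ∷ []
perms-length (suc m) = Allₚ.concat⁺ (Allₚ.map⁺ (All.map
  (λ {σ} |σ|≡m → All.map (λ eq → ≡.trans eq (cong suc |σ|≡m)) (insertAll-length (suc m) σ))
  (perms-length m)))

𝔖-subAt : ∀ i r α →
  𝔖 (subAt i r α) ≡ concatMap (λ σ → sgn σ ·ᴺ Hℤ (subAt i r (shiftBy 1 α σ))) (perms (length α))
𝔖-subAt i r α rewrite length-subAt i r α =
  concatMap-cong (λ σ → cong (λ xs → sgn σ ·ᴺ Hℤ xs) (shiftBy-subAt 1 i r α σ)) (perms (length α))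

corollary6p2 : (α : List ℤ) (r : ℕ) → 0 < r →
    M (r ∷ []) ⊥ 𝔖 α ≡ ΣN (map (λ i → 𝔖 (subAt i r α)) (upTo (length α)))
corollary6p2 α (suc r) _ K K∈QSym = begin
  ⟨ ΣN (map (λ i → 𝔖 (subAt i (suc r) α)) (upTo m)) , K ⟩
    ≡⟨ pairing-concatMapˡ (λ i → 𝔖 (subAt i (suc r) α)) (upTo m) K ⟩
  ∑ (upTo m) (λ i → ⟨ 𝔖 (subAt i (suc r) α) , K ⟩)
    ≡⟨ ∑-cong (upTo m) (λ i →
         ≡.trans (cong ⟨_, K ⟩ (𝔖-subAt i (suc r) α)) (pairing-concatMap-· sgn _ (perms m) K)) ⟩
  ∑ (upTo m) (λ i → ∑ (perms m) (λ σ → sgn σ * ⟨ Hℤ (subAt i (suc r) (shiftBy 1 α σ)) , K ⟩))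
    ≡⟨ ∑-swap (upTo m) (perms m) _ ⟩
  ∑ (perms m) (λ σ → ∑ (upTo m) (λ i → sgn σ * ⟨ Hℤ (subAt i (suc r) (shiftBy 1 α σ)) , K ⟩))
    ≡⟨ ∑-congᴬ (All.map (λ {σ} |σ|≡m →
         ≡.trans (∑-*ˡ (upTo m) (sgn σ) _) (cong (sgn σ *_) (pieri σ |σ|≡m))) (perms-length m)) ⟩
  ∑ (perms m) (λ σ → sgn σ * ⟨ Hℤ (shiftBy 1 α σ) , M (suc r ∷ []) *ᴽ K ⟩)
    ≡⟨ pairing-concatMap-· sgn (Hℤ ∘ shiftBy 1 α) (perms m) _ ⟨
  ⟨ 𝔖 α , M (suc r ∷ []) *ᴽ K ⟩ ∎
  where
  open ≡.≡-Reasoning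
  m : ℕ
  m = length α
  pieri : ∀ σ → length σ ≡ m →
    ∑ (upTo m) (λ i → ⟨ Hℤ (subAt i (suc r) (shiftBy 1 α σ)) , K ⟩)
      ≡ ⟨ Hℤ (shiftBy 1 α σ) , M (suc r ∷ []) *ᴽ K ⟩
  pieri σ |σ|≡m =
    ≡.subst (λ n → ∑ (upTo n) (λ i → ⟨ Hℤ (subAt i (suc r) ys) , K ⟩)
                     ≡ ⟨ Hℤ ys , M (suc r ∷ []) *ᴽ K ⟩)
            (length-shiftBy 1 α σ |σ|≡m)
            (≡.trans (≡.sym (pairing-concatMapˡ (λ i → Hℤ (subAt i (suc r) ys)) (upTo (length ys)) K))
                     (M⊥Hℤ r ys K K∈QSym))
    where
    ys : List ℤ
    ys = shiftBy 1 α σ
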